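{- For $I\subseteq[n-1]$ let $I^c=[n-1]\setminus I$. Then $I,J\subseteq[n-1]$ have the same run decomposition if and only if the compositions $\alpha_{I^c}$ and $\alpha_{J^c}$ are rearrangements of each other.
   Context: The run decomposition of a finite set $I$ of positive integers is the partition of $|I|$ formed by the sizes, sorted nonincreasingly, of the maximal runs of consecutive integers in $I$. A composition of $n$ is a sequence of positive integers summing to $n$. For $T=\{t_1<\dots<t_{k-1}\}\subseteq[n-1]$, $\alpha_T$ is the composition $(t_1,t_2-t_1,\dots,t_{k-1}-t_{k-2},n-t_{k-1})$ of $n$ (this is the inverse of the bijection $(\alpha_1,\dots,\alpha_k)\mapsto\{\alpha_1,\alpha_1+\alpha_2,\dots,\alpha_1+\dots+\alpha_{k-1}\}$). -}

module Defs where

open import Data.Bool using (Bool; true; false; not)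
open import Data.Nat using (ℕ; zero; suc)
open import Data.Nat.Properties using (≤-decTotalOrder)
open import Data.List using (List; []; _∷_)
open import Data.Vec using (Vec; toList; map)
import Relation.Binary.Construct.Flip.EqAndOrd as Flip
import Data.List.Sort as Sort

-- Convention: a subset I ⊆ [m] = {1,…,m} is a characteristic vector
-- I : Vec Bool m, where position i (0-based) records whether i+1 ∈ I.

compl : ∀ {m} → Vec Bool m → Vec Bool m
compl = map not

-- The accumulator is the
-- length of the run currently being read (0 = not inside a run).
runsFrom : ℕ → List Bool → List ℕ
runsFrom zero    []           = []
runsFrom (suc k) []           = suc k ∷ []
runsFrom k       (true ∷ bs)  = runsFrom (suc k) bs
runsFrom zero    (false ∷ bs) = runsFrom zero bs
runsFrom (suc k) (false ∷ bs) = suc k ∷ runsFrom zero bs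

private
  module SortDesc = Sort (Flip.decTotalOrder ≤-decTotalOrder)

sortDesc : List ℕ → List ℕ
sortDesc = SortDesc.sort

runDecomposition : ∀ {m} → Vec Bool m → List ℕ
runDecomposition I = sortDesc (runsFrom zero (toList I))

-- α_T for T ⊆ [n-1] with n = suc m: the composition
-- (t₁, t₂ - t₁, …, n - t_{k-1}).  The accumulator c is the current
-- part length (distance from the last cut point).
compFrom : ℕ → List Bool → List ℕ
compFrom c []           = c ∷ []
compFrom c (true ∷ bs)  = c ∷ compFrom 1 bs
compFrom c (false ∷ bs) = compFrom (suc c) bs

α : ∀ {m} → Vec Bool m → List ℕ
α T = compFrom 1 (toList T)

{-# OPTIONS --safe #-}
module Submission where

-- Cutting [n-1] at the elements of I^c splits it into |I^c| + 1 consecutive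
-- blocks, each a (possibly empty) run of I; the parts of α_{I^c} are these
-- block sizes plus one, while the run decomposition of I lists the nonempty
-- ones.  So the multiset of block sizes determines both invariants, and
-- conversely each invariant determines it: for α_{I^c} subtract one from
-- every part; for the run decomposition, the number of empty blocks is
-- recovered from (sum of sizes) + (number of blocks) = n.

open import Defs
open import Data.Bool using (Bool; true; false; not)
open import Data.Nat using (ℕ; zero; suc; _+_; _∸_; _<?_)
open import Data.Nat.Properties
  using (≤-decTotalOrder; suc-injective; +-suc; +-assoc; +-comm; +-cancelˡ-≡; +-∸-assoc)
open import Data.Nat.ListAction using (sum)
open import Data.Nat.ListAction.Properties using (sum-↭)
open import Data.List using (List; []; _∷_; _++_; length; replicate; map; filter)
open import Data.List.Properties using (map-injective; length-filter)
open import Data.List.Relation.Binary.Permutation.Propositional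
  using (_↭_; prep; ↭-refl; ↭-sym; ↭-trans; ↭⇒↭ₛ; module PermutationReasoning)
open import Data.List.Relation.Binary.Permutation.Propositional.Properties
  using (map⁺; ↭-map-inv; ↭-length; ++⁺ˡ; shift; filter-↭)
open import Data.List.Relation.Binary.Equality.Propositional using (≋⇒≡)
open import Data.List.Relation.Unary.Sorted.TotalOrder.Properties using (↗↭↗⇒≋)
open import Data.Vec using (Vec; toList)
open import Data.Vec.Properties using (toList-map; length-toList)
open import Data.Product using (_,_)
open import Function.Bundles using (_⇔_; mk⇔)
open import Function.Definitions using (Injective)
import Function.Properties.Equivalence as ⇔
open import Relation.Binary.Bundles using (DecTotalOrder)
import Relation.Binary.Construct.Flip.EqAndOrd as Flip
open import Relation.Binary.PropositionalEquality
  using (_≡_; refl; sym; trans; cong; cong₂; module ≡-Reasoning)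
import Data.List.Sort as Sort

private
  variable
    A B : Set
    xs ys : List A

↭-map⁻ : {f : A → B} → Injective _≡_ _≡_ f → map f xs ↭ map f ys → xs ↭ ys
↭-map⁻ {f = f} f-inj p with zs , ys≡zs , xs↭zs ← ↭-map-inv f p
  rewrite map-injective f-inj ys≡zs = xs↭zs

map-↭⇔↭ : {f : A → B} → Injective _≡_ _≡_ f → (map f xs ↭ map f ys) ⇔ (xs ↭ ys)
map-↭⇔↭ {f = f} f-inj = mk⇔ (↭-map⁻ f-inj) (map⁺ f)

positives : List ℕ → List ℕ
positives = filter (0 <?_)

sum-positives : ∀ xs → sum (positives xs) ≡ sum xs
sum-positives []           = refl
sum-positives (zero ∷ xs)  = sum-positives xs
sum-positives (suc x ∷ xs) = cong (suc x +_) (sum-positives xs)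

↭-zeros-++-positives : ∀ xs →
  xs ↭ replicate (length xs ∸ length (positives xs)) 0 ++ positives xs
↭-zeros-++-positives []           = ↭-refl
↭-zeros-++-positives (zero ∷ xs)
  rewrite +-∸-assoc 1 (length-filter (0 <?_) xs) = prep 0 (↭-zeros-++-positives xs)
↭-zeros-++-positives (suc x ∷ xs) =
  ↭-trans (prep (suc x) (↭-zeros-++-positives xs)) (↭-sym (shift (suc x) _ _))

↭-positives⁻ : positives xs ↭ positives ys → length xs ≡ length ys → xs ↭ ys
↭-positives⁻ {xs} {ys} p |xs|≡|ys| = begin
  xs                                                   ↭⟨ ↭-zeros-++-positives xs ⟩
  replicate (length xs ∸ length (positives xs)) 0 ++ positives xs
    ≡⟨ cong (λ z → replicate z 0 ++ positives xs) (cong₂ _∸_ |xs|≡|ys| (↭-length p)) ⟩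
  replicate (length ys ∸ length (positives ys)) 0 ++ positives xs ↭⟨ ++⁺ˡ _ p ⟩
  replicate (length ys ∸ length (positives ys)) 0 ++ positives ys ↭⟨ ↭-zeros-++-positives ys ⟨
  ys                                                   ∎
  where open PermutationReasoning

private
  ≥-decTotalOrder : DecTotalOrder _ _ _
  ≥-decTotalOrder = Flip.decTotalOrder ≤-decTotalOrder

  open module SortDesc = Sort ≥-decTotalOrder using (sort-↭; sort-↗)

sortDesc-≡⇔↭ : {xs ys : List ℕ} → (sortDesc xs ≡ sortDesc ys) ⇔ (xs ↭ ys)
sortDesc-≡⇔↭ {xs} {ys} = mk⇔ to from
  where
  to : sortDesc xs ≡ sortDesc ys → xs ↭ ys
  to eq = begin
    xs          ↭⟨ sort-↭ xs ⟨
    sortDesc xs ≡⟨ eq ⟩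
    sortDesc ys ↭⟨ sort-↭ ys ⟩
    ys          ∎
    where open PermutationReasoning

  from : xs ↭ ys → sortDesc xs ≡ sortDesc ys
  from p = ≋⇒≡ (↗↭↗⇒≋ (DecTotalOrder.totalOrder ≥-decTotalOrder) (sort-↗ xs) (sort-↗ ys)
    (↭⇒↭ₛ (↭-trans (sort-↭ xs) (↭-trans p (↭-sym (sort-↭ ys))))))

-- Like runsFrom, but keeping the empty runs: the sizes of all the blocks
-- into which the falses (the elements of the complement) cut the list.
blocksFrom : ℕ → List Bool → List ℕ
blocksFrom k []           = k ∷ []
blocksFrom k (true ∷ bs)  = blocksFrom (suc k) bs
blocksFrom k (false ∷ bs) = k ∷ blocksFrom zero bs

compFrom-map-not : ∀ k bs → compFrom (suc k) (map not bs) ≡ map suc (blocksFrom k bs)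
compFrom-map-not k []           = refl
compFrom-map-not k (true ∷ bs)  = compFrom-map-not (suc k) bs
compFrom-map-not k (false ∷ bs) = cong (suc k ∷_) (compFrom-map-not zero bs)

runsFrom≡positives-blocksFrom : ∀ k bs → runsFrom k bs ≡ positives (blocksFrom k bs)
runsFrom≡positives-blocksFrom zero    []           = refl
runsFrom≡positives-blocksFrom (suc k) []           = refl
runsFrom≡positives-blocksFrom zero    (true ∷ bs)  = runsFrom≡positives-blocksFrom 1 bs
runsFrom≡positives-blocksFrom (suc k) (true ∷ bs)  = runsFrom≡positives-blocksFrom (suc (suc k)) bs
runsFrom≡positives-blocksFrom zero    (false ∷ bs) = runsFrom≡positives-blocksFrom zero bs
runsFrom≡positives-blocksFrom (suc k) (false ∷ bs) =
  cong (suc k ∷_) (runsFrom≡positives-blocksFrom zero bs)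

sum+length-blocksFrom : ∀ k bs →
  sum (blocksFrom k bs) + length (blocksFrom k bs) ≡ suc (k + length bs)
sum+length-blocksFrom k []           = +-comm (k + 0) 1
sum+length-blocksFrom k (true ∷ bs)  =
  trans (sum+length-blocksFrom (suc k) bs) (cong suc (sym (+-suc k (length bs))))
sum+length-blocksFrom k (false ∷ bs) = begin
  (k + S) + suc L   ≡⟨ +-suc (k + S) L ⟩
  suc ((k + S) + L) ≡⟨ cong suc (+-assoc k S L) ⟩
  suc (k + (S + L)) ≡⟨ cong (λ n → suc (k + n)) (sum+length-blocksFrom zero bs) ⟩
  suc (k + suc (length bs)) ∎
  where
  open ≡-Reasoning
  S = sum (blocksFrom zero bs)
  L = length (blocksFrom zero bs)

blocks : ∀ {m} → Vec Bool m → List ℕ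
blocks I = blocksFrom zero (toList I)

sum+length-blocks : ∀ {m} (I : Vec Bool m) → sum (blocks I) + length (blocks I) ≡ suc m
sum+length-blocks I = trans (sum+length-blocksFrom zero (toList I)) (cong suc (length-toList I))

positives-blocks-↭⇔↭ : ∀ {m} (I J : Vec Bool m) →
  (positives (blocks I) ↭ positives (blocks J)) ⇔ (blocks I ↭ blocks J)
positives-blocks-↭⇔↭ {m} I J = mk⇔ to (filter-↭ (0 <?_))
  where
  to : positives (blocks I) ↭ positives (blocks J) → blocks I ↭ blocks J
  to p = ↭-positives⁻ p (+-cancelˡ-≡ _ _ _ (begin
    sum (blocks I) + length (blocks I) ≡⟨ sum+length-blocks I ⟩
    suc m                              ≡⟨ sum+length-blocks J ⟨
    sum (blocks J) + length (blocks J) ≡⟨ cong (_+ length (blocks J)) same-sum ⟨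
    sum (blocks I) + length (blocks J) ∎))
    where
    open ≡-Reasoning
    same-sum : sum (blocks I) ≡ sum (blocks J)
    same-sum = begin
      sum (blocks I)             ≡⟨ sum-positives (blocks I) ⟨
      sum (positives (blocks I)) ≡⟨ sum-↭ p ⟩
      sum (positives (blocks J)) ≡⟨ sum-positives (blocks J) ⟩
      sum (blocks J)             ∎

runDecomposition≡sortDesc-positives-blocks : ∀ {m} (I : Vec Bool m) →
  runDecomposition I ≡ sortDesc (positives (blocks I))
runDecomposition≡sortDesc-positives-blocks I =
  cong sortDesc (runsFrom≡positives-blocksFrom zero (toList I))

α-compl≡map-suc-blocks : ∀ {m} (I : Vec Bool m) → α (compl I) ≡ map suc (blocks I)
α-compl≡map-suc-blocks I =
  trans (cong (compFrom 1) (toList-map not I)) (compFrom-map-not zero (toList I))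

proposition3p18 : (m : ℕ) (I J : Vec Bool m) →
    (runDecomposition I ≡ runDecomposition J) ⇔ (α (compl I) ↭ α (compl J))
proposition3p18 m I J
  rewrite runDecomposition≡sortDesc-positives-blocks I
        | runDecomposition≡sortDesc-positives-blocks J
        | α-compl≡map-suc-blocks I
        | α-compl≡map-suc-blocks J
  = ⇔.trans sortDesc-≡⇔↭
      (⇔.trans (positives-blocks-↭⇔↭ I J) (⇔.sym (map-↭⇔↭ suc-injective)))
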